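{- If $q\ge 7$ is an integer, then $\operatorname{achr}(K_6\square K_q)\le 2q+6$.
   Context: For a finite simple graph $G$, $\operatorname{achr}(G)$ (the achromatic number) is the maximum number of colours in a proper vertex colouring of $G$ that is complete, i.e. every pair of distinct colours appears on the two ends of some edge. $K_6\square K_q$ is the Cartesian product of the complete graphs $K_6$ and $K_q$ (vertex set $[1,6]\times[1,q]$, two vertices adjacent iff they agree in exactly one coordinate). -}

module Defs where

open import Data.Nat using (ℕ)
open import Data.Fin using (Fin)
open import Data.Product using (_×_; _,_; ∃-syntax; proj₁; proj₂)
open import Data.Sum using (_⊎_)
open import Relation.Binary.PropositionalEquality using (_≡_)
open import Relation.Nullary using (¬_)

CartAdj : {p q : ℕ} → (Fin p × Fin q) → (Fin p × Fin q) → Set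
CartAdj (a , b) (c , d) = (a ≡ c × ¬ b ≡ d) ⊎ (¬ a ≡ c × b ≡ d)

IsProper : {p q k : ℕ} → (Fin p × Fin q → Fin k) → Set
IsProper {p} {q} col = ∀ u v → CartAdj {p} {q} u v → ¬ col u ≡ col v

IsComplete : {p q k : ℕ} → (Fin p × Fin q → Fin k) → Set
IsComplete {p} {q} {k} col =
  ∀ (i j : Fin k) → ¬ i ≡ j →
    ∃[ u ] ∃[ v ] (CartAdj {p} {q} u v × col u ≡ i × col v ≡ j)

IsCompleteColouring : (p q k : ℕ) → (Fin p × Fin q → Fin k) → Set
IsCompleteColouring p q k col =
  IsProper {p} {q} col × IsComplete {p} {q} col × (∀ (i : Fin k) → ∃[ u ] col u ≡ i)

-- Suppose k ≥ 2q + 7. A colour class is independent, so it meets every row and every column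
-- at most once, and the class sizes add up to 6q. A singleton class {u} would force every
-- other colour onto the q + 4 neighbours of u, so every class has at least two vertices.
-- If a class {v₁, v₂} has exactly two vertices, every other colour appears among the 2q + 8
-- vertices sharing a row or a column with v₁ or v₂; a second class meeting both rows of v₁
-- and v₂ would put two more vertices there, forcing k + 2 ≤ 2q + 8. So distinct two-vertex
-- classes occupy distinct pairs of rows, there are at most 15 of them, and 3k ≤ 6q + 15.
module Submission where

open import Defs
open import Data.Fin using (Fin; zero; suc; punchIn; punchOut)
open import Data.Fin.Properties using (_≟_; punchIn-punchOut; punchOut-injective; punchInᵢ≢i)
open import Data.Nat using (ℕ; zero; suc; _+_; _*_; _∸_; _≤_; _<_; _≤?_; _<?_; z≤n; s≤s; z<s)
open import Data.Nat.Properties hiding (_≟_)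
open import Data.Nat.Properties using () renaming (_≟_ to _≟ℕ_)
open import Algebra.Properties.Semiring.Sum +-*-semiring
  using (sum; sum-syntax; sum-cong-≗; sum-replicate-zero; sum-remove; ∑-distrib-+; ∑-comm;
         *-distribˡ-sum; *-distribʳ-sum)
open import Data.Nat.Tactic.RingSolver using (solve-∀)
open import Data.Product using (_×_; _,_; ∃-syntax; proj₁; proj₂)
open import Data.Product.Properties using (≡-dec)
open import Data.Sum as Sum using (_⊎_; inj₁; inj₂)
open import Function using (_∘_)
open import Level using (Level)
open import Relation.Binary.PropositionalEquality
open import Relation.Nullary using (¬_; Dec; yes; no; contradiction)
open import Relation.Nullary.Decidable using (_⊎-dec_; _×-dec_; ¬?; from-no)
open import Relation.Unary using (Pred; Decidable)

private variable
  ℓ ℓ′ : Level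
  A : Set ℓ
  B : Set ℓ′
  n : ℕ

𝟙 : Dec A → ℕ
𝟙 (yes _) = 1
𝟙 (no _)  = 0

𝟙-yes : (d : Dec A) → A → 𝟙 d ≡ 1
𝟙-yes (yes _) _ = refl
𝟙-yes (no ¬a) a = contradiction a ¬a

𝟙-no : (d : Dec A) → ¬ A → 𝟙 d ≡ 0
𝟙-no (yes a) ¬a = contradiction a ¬a
𝟙-no (no _)  _  = refl

𝟙≤1 : (d : Dec A) → 𝟙 d ≤ 1
𝟙≤1 (yes _) = s≤s z≤n
𝟙≤1 (no _)  = z≤n

𝟙>0⇒ : (d : Dec A) → 0 < 𝟙 d → A
𝟙>0⇒ (yes a) _ = a

*-𝟙-≤ : ∀ m {x} (d : Dec A) → (A → m ≤ x) → m * 𝟙 d ≤ x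
*-𝟙-≤ m (yes a) m≤x = ≤-trans (≤-reflexive (*-identityʳ m)) (m≤x a)
*-𝟙-≤ m (no _)  _   = ≤-trans (≤-reflexive (*-zeroʳ m)) z≤n

𝟙-⊎ : ¬ (A × B) → (a : Dec A) (b : Dec B) → 𝟙 (a ⊎-dec b) ≡ 𝟙 a + 𝟙 b
𝟙-⊎ ¬ab (yes a) (yes b) = contradiction (a , b) ¬ab
𝟙-⊎ _   (yes _) (no _)  = refl
𝟙-⊎ _   (no _)  (yes _) = refl
𝟙-⊎ _   (no _)  (no _)  = refl

∑-mono-≤ : {f g : Fin n → ℕ} → (∀ x → f x ≤ g x) → sum f ≤ sum g
∑-mono-≤ {zero}  _   = z≤n
∑-mono-≤ {suc n} f≤g = +-mono-≤ (f≤g zero) (∑-mono-≤ (f≤g ∘ suc))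

∑-const : ∀ n c → ∑[ _ < n ] c ≡ n * c
∑-const zero    c = refl
∑-const (suc n) c = cong (c +_) (∑-const n c)

∑-zero : {f : Fin n → ℕ} → (∀ x → f x ≡ 0) → sum f ≡ 0
∑-zero {n} f≡0 = trans (sum-cong-≗ f≡0) (sum-replicate-zero n)

n≤∑ : {f : Fin n → ℕ} → (∀ x → 1 ≤ f x) → n ≤ sum f
n≤∑ {n} {f} f≥1 = subst (_≤ sum f) (trans (∑-const n 1) (*-identityʳ n)) (∑-mono-≤ f≥1)

≤-∑ : (f : Fin n → ℕ) (a : Fin n) → f a ≤ sum f
≤-∑ {suc n} f a = ≤-trans (m≤m+n (f a) _) (≤-reflexive (sym (sum-remove f)))

two-≤-∑ : (f : Fin n → ℕ) {a b : Fin n} → a ≢ b → f a + f b ≤ sum f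
two-≤-∑ {suc n} f {a} {b} a≢b = begin
  f a + f b
    ≡⟨ cong (f a +_) (cong f (punchIn-punchOut a≢b)) ⟨
  f a + f (punchIn a (punchOut a≢b))
    ≤⟨ +-monoʳ-≤ (f a) (≤-∑ (f ∘ punchIn a) (punchOut a≢b)) ⟩
  f a + sum (f ∘ punchIn a)
    ≡⟨ sum-remove f ⟨
  sum f ∎
  where open ≤-Reasoning

three-≤-∑ : (f : Fin n → ℕ) {a b c : Fin n} → a ≢ b → a ≢ c → b ≢ c → f a + f b + f c ≤ sum f
three-≤-∑ {suc n} f {a} {b} {c} a≢b a≢c b≢c = begin
  f a + f b + f c
    ≡⟨ +-assoc (f a) (f b) (f c) ⟩
  f a + (f b + f c)
    ≡⟨ cong (f a +_) (cong₂ _+_ (cong f (punchIn-punchOut a≢b)) (cong f (punchIn-punchOut a≢c))) ⟨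
  f a + (f (punchIn a (punchOut a≢b)) + f (punchIn a (punchOut a≢c)))
    ≤⟨ +-monoʳ-≤ (f a) (two-≤-∑ (f ∘ punchIn a) (b≢c ∘ punchOut-injective a≢b a≢c)) ⟩
  f a + sum (f ∘ punchIn a)
    ≡⟨ sum-remove f ⟨
  sum f ∎
  where open ≤-Reasoning

n+2≤∑ : {f : Fin n → ℕ} {a b : Fin n} → (∀ x → 1 ≤ f x) → a ≢ b → 2 ≤ f a → 2 ≤ f b →
        n + 2 ≤ sum f
n+2≤∑ {n} {f} {a} {b} f≥1 a≢b fa≥2 fb≥2 = begin
  n + 2
    ≤⟨ +-monoʳ-≤ n (≤-trans (+-mono-≤ (∸-monoˡ-≤ 1 fa≥2) (∸-monoˡ-≤ 1 fb≥2)) (two-≤-∑ g a≢b)) ⟩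
  n + sum g
    ≡⟨ cong (_+ sum g) (trans (∑-const n 1) (*-identityʳ n)) ⟨
  ∑[ x < n ] 1 + sum g
    ≡⟨ ∑-distrib-+ (λ _ → 1) g ⟨
  ∑[ x < n ] (1 + g x)
    ≡⟨ sum-cong-≗ (λ x → m+[n∸m]≡n (f≥1 x)) ⟩
  sum f ∎
  where
  open ≤-Reasoning
  g : Fin n → ℕ
  g x = f x ∸ 1

∑>0⇒∃ : (f : Fin n → ℕ) → 0 < sum f → ∃[ x ] 0 < f x
∑>0⇒∃ {suc n} f ∑f>0 with f zero in eq
... | suc _ = zero , subst (0 <_) (sym eq) z<s
... | zero with x , fx>0 ← ∑>0⇒∃ (f ∘ suc) ∑f>0 = suc x , fx>0

f<∑⇒∃-other : (f : Fin n → ℕ) (a : Fin n) → f a < sum f → ∃[ b ] b ≢ a × 0 < f b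
f<∑⇒∃-other {suc n} f a fa<∑f =
  let x , fx>0 = ∑>0⇒∃ (f ∘ punchIn a) (+-cancelˡ-≤ (f a) 1 _ fa+1≤fa+rest)
  in punchIn a x , punchInᵢ≢i a x , fx>0
  where
  fa+1≤fa+rest : f a + 1 ≤ f a + sum (f ∘ punchIn a)
  fa+1≤fa+rest = subst₂ _≤_ (+-comm 1 (f a)) (sum-remove f) fa<∑f

module _ {P : Pred (Fin n) ℓ} (P? : Decidable P) where

  ∑-𝟙-none : (∀ x → ¬ P x) → ∑[ x < n ] 𝟙 (P? x) ≡ 0
  ∑-𝟙-none ¬P = ∑-zero (λ x → 𝟙-no (P? x) (¬P x))

  ∑-𝟙-≤1 : (∀ x y → P x → P y → x ≡ y) → ∑[ x < n ] 𝟙 (P? x) ≤ 1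
  ∑-𝟙-≤1 unique with ∑[ x < n ] 𝟙 (P? x) ≤? 1
  ... | yes ∑≤1 = ∑≤1
  ... | no ∑≰1
    with a , Pa ← ∑>0⇒∃ (𝟙 ∘ P?) (≤-trans (s≤s z≤n) (≰⇒> ∑≰1))
    with b , b≢a , Pb ← f<∑⇒∃-other (𝟙 ∘ P?) a (<-≤-trans (s≤s (𝟙≤1 (P? a))) (≰⇒> ∑≰1))
    = contradiction (unique b a (𝟙>0⇒ (P? b) Pb) (𝟙>0⇒ (P? a) Pa)) b≢a

  ∑-𝟙-≤-𝟙 : (d : Dec A) → (∀ x → P x → A) → (∀ x y → P x → P y → x ≡ y) →
            ∑[ x < n ] 𝟙 (P? x) ≤ 𝟙 d
  ∑-𝟙-≤-𝟙 (yes _) _   unique = ∑-𝟙-≤1 unique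
  ∑-𝟙-≤-𝟙 (no ¬a) P⇒A _      = ≤-reflexive (∑-𝟙-none (λ x → ¬a ∘ P⇒A x))

∑-𝟙-≟ : (a : Fin n) → ∑[ x < n ] 𝟙 (a ≟ x) ≡ 1
∑-𝟙-≟ {suc n} a = begin
  ∑[ x < suc n ] 𝟙 (a ≟ x)
    ≡⟨ sum-remove (λ x → 𝟙 (a ≟ x)) ⟩
  𝟙 (a ≟ a) + ∑[ x < n ] 𝟙 (a ≟ punchIn a x)
    ≡⟨ cong₂ _+_ (𝟙-yes (a ≟ a) refl)
                 (∑-𝟙-none (λ x → a ≟ punchIn a x) (λ x → punchInᵢ≢i a x ∘ sym)) ⟩
  1 ∎
  where open ≡-Reasoning

pair? : (a b : Fin n) → Decidable (λ x → a ≡ x ⊎ b ≡ x)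
pair? a b x = a ≟ x ⊎-dec b ≟ x

∑-𝟙-pair? : {a b : Fin n} → a ≢ b → sum (𝟙 ∘ pair? a b) ≡ 2
∑-𝟙-pair? {n} {a} {b} a≢b = begin
  ∑[ x < n ] 𝟙 (a ≟ x ⊎-dec b ≟ x)
    ≡⟨ sum-cong-≗ (λ x → 𝟙-⊎ (λ (a≡x , b≡x) → a≢b (trans a≡x (sym b≡x))) (a ≟ x) (b ≟ x)) ⟩
  ∑[ x < n ] (𝟙 (a ≟ x) + 𝟙 (b ≟ x))
    ≡⟨ ∑-distrib-+ (λ x → 𝟙 (a ≟ x)) (λ x → 𝟙 (b ≟ x)) ⟩
  ∑[ x < n ] 𝟙 (a ≟ x) + ∑[ x < n ] 𝟙 (b ≟ x)
    ≡⟨ cong₂ _+_ (∑-𝟙-≟ a) (∑-𝟙-≟ b) ⟩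
  2 ∎
  where open ≡-Reasoning

module _ {p q : ℕ} where

  ∑² : (Fin p × Fin q → ℕ) → ℕ
  ∑² f = ∑[ r < p ] ∑[ c < q ] f (r , c)

  ∑²-mono-≤ : {f g : Fin p × Fin q → ℕ} → (∀ v → f v ≤ g v) → ∑² f ≤ ∑² g
  ∑²-mono-≤ f≤g = ∑-mono-≤ (λ r → ∑-mono-≤ (λ c → f≤g (r , c)))

  ≤-∑² : (f : Fin p × Fin q → ℕ) (v : Fin p × Fin q) → f v ≤ ∑² f
  ≤-∑² f (r , c) = ≤-trans (≤-∑ (λ c → f (r , c)) c) (≤-∑ (λ r → ∑[ c < q ] f (r , c)) r)

  two-rows-≤-∑² : (f : Fin p × Fin q → ℕ) {r r′ : Fin p} (c c′ : Fin q) → r ≢ r′ →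
                  f (r , c) + f (r′ , c′) ≤ ∑² f
  two-rows-≤-∑² f {r} {r′} c c′ r≢r′ =
    ≤-trans (+-mono-≤ (≤-∑ (λ c → f (r , c)) c) (≤-∑ (λ c → f (r′ , c)) c′))
            (two-≤-∑ (λ r → ∑[ c < q ] f (r , c)) r≢r′)

  ∑²-distrib-+ : (f g : Fin p × Fin q → ℕ) → ∑² (λ v → f v + g v) ≡ ∑² f + ∑² g
  ∑²-distrib-+ f g =
    trans (sum-cong-≗ (λ r → ∑-distrib-+ (λ c → f (r , c)) (λ c → g (r , c))))
          (∑-distrib-+ (λ r → ∑[ c < q ] f (r , c)) (λ r → ∑[ c < q ] g (r , c)))

  ∑-∑²-comm : ∀ {k} (f : Fin p × Fin q → Fin k → ℕ) →
              ∑[ j < k ] ∑² (λ v → f v j) ≡ ∑² (λ v → ∑[ j < k ] f v j)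
  ∑-∑²-comm f = trans (sym (∑-comm (λ r j → ∑[ c < q ] f (r , c) j)))
                      (sum-cong-≗ (λ r → sym (∑-comm (λ c j → f (r , c) j))))

  ∑²-row : (f : Fin p → ℕ) → ∑² (f ∘ proj₁) ≡ q * sum f
  ∑²-row f = begin
    ∑[ r < p ] ∑[ c < q ] f r  ≡⟨ sum-cong-≗ (λ r → trans (∑-const q (f r)) (*-comm q (f r))) ⟩
    ∑[ r < p ] (f r * q)       ≡⟨ *-distribʳ-sum q f ⟨
    sum f * q                  ≡⟨ *-comm (sum f) q ⟩
    q * sum f                  ∎
    where open ≡-Reasoning

  ∑²-column : (g : Fin q → ℕ) → ∑² (g ∘ proj₂) ≡ p * sum g
  ∑²-column g = ∑-const p (sum g)

  ∑²-* : (f : Fin p → ℕ) (g : Fin q → ℕ) → ∑² (λ (r , c) → f r * g c) ≡ sum f * sum g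
  ∑²-* f g = begin
    ∑[ r < p ] ∑[ c < q ] (f r * g c)  ≡⟨ sum-cong-≗ (λ r → *-distribˡ-sum (f r) g) ⟨
    ∑[ r < p ] (f r * sum g)           ≡⟨ *-distribʳ-sum (sum g) f ⟨
    sum f * sum g                      ∎
    where open ≡-Reasoning

  Cross : Pred (Fin p) ℓ → Pred (Fin q) ℓ → Pred (Fin p × Fin q) ℓ
  Cross P Q (r , c) = P r ⊎ Q c

  CartAdj⇒Cross : {a : Fin p} {b : Fin q} {v : Fin p × Fin q} →
                  CartAdj (a , b) v → Cross (a ≡_) (b ≡_) v
  CartAdj⇒Cross (inj₁ (a≡r , _)) = inj₁ a≡r
  CartAdj⇒Cross (inj₂ (_ , b≡c)) = inj₂ b≡c

  module _ {P : Pred (Fin p) ℓ} {Q : Pred (Fin q) ℓ} (P? : Decidable P) (Q? : Decidable Q) where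

    cross? : Decidable (Cross P Q)
    cross? (r , c) = P? r ⊎-dec Q? c

    ∑²-𝟙-cross : ∑² (𝟙 ∘ cross?) + sum (𝟙 ∘ P?) * sum (𝟙 ∘ Q?) ≡
                 q * sum (𝟙 ∘ P?) + p * sum (𝟙 ∘ Q?)
    ∑²-𝟙-cross = begin
      ∑² (𝟙 ∘ cross?) + sum (𝟙 ∘ P?) * sum (𝟙 ∘ Q?)
        ≡⟨ cong (∑² (𝟙 ∘ cross?) +_) (∑²-* (𝟙 ∘ P?) (𝟙 ∘ Q?)) ⟨
      ∑² (𝟙 ∘ cross?) + ∑² (λ (r , c) → 𝟙 (P? r) * 𝟙 (Q? c))
        ≡⟨ ∑²-distrib-+ (𝟙 ∘ cross?) (λ (r , c) → 𝟙 (P? r) * 𝟙 (Q? c)) ⟨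
      ∑² (λ (r , c) → 𝟙 (P? r ⊎-dec Q? c) + 𝟙 (P? r) * 𝟙 (Q? c))
        ≡⟨ sum-cong-≗ (λ r → sum-cong-≗ (λ c → inclusion–exclusion (P? r) (Q? c))) ⟩
      ∑² (λ (r , c) → 𝟙 (P? r) + 𝟙 (Q? c))
        ≡⟨ ∑²-distrib-+ (𝟙 ∘ P? ∘ proj₁) (𝟙 ∘ Q? ∘ proj₂) ⟩
      ∑² (𝟙 ∘ P? ∘ proj₁) + ∑² (𝟙 ∘ Q? ∘ proj₂)
        ≡⟨ cong₂ _+_ (∑²-row (𝟙 ∘ P?)) (∑²-column (𝟙 ∘ Q?)) ⟩
      q * sum (𝟙 ∘ P?) + p * sum (𝟙 ∘ Q?) ∎
      where
      open ≡-Reasoning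
      inclusion–exclusion : (a : Dec A) (b : Dec B) → 𝟙 (a ⊎-dec b) + 𝟙 a * 𝟙 b ≡ 𝟙 a + 𝟙 b
      inclusion–exclusion (yes _) (yes _) = refl
      inclusion–exclusion (yes _) (no _)  = refl
      inclusion–exclusion (no _)  (yes _) = refl
      inclusion–exclusion (no _)  (no _)  = refl

  ∑²-𝟙-cross-point : (a : Fin p) (b : Fin q) → ∑² (𝟙 ∘ cross? (a ≟_) (b ≟_)) + 1 ≡ p + q
  ∑²-𝟙-cross-point a b = begin
    ∑² (𝟙 ∘ X?) + 1
      ≡⟨ cong₂ (λ s t → ∑² (𝟙 ∘ X?) + s * t) (∑-𝟙-≟ a) (∑-𝟙-≟ b) ⟨
    ∑² (𝟙 ∘ X?) + sum (𝟙 ∘ (a ≟_)) * sum (𝟙 ∘ (b ≟_))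
      ≡⟨ ∑²-𝟙-cross (a ≟_) (b ≟_) ⟩
    q * sum (𝟙 ∘ (a ≟_)) + p * sum (𝟙 ∘ (b ≟_))
      ≡⟨ cong₂ (λ s t → q * s + p * t) (∑-𝟙-≟ a) (∑-𝟙-≟ b) ⟩
    q * 1 + p * 1
      ≡⟨ trans (cong₂ _+_ (*-identityʳ q) (*-identityʳ p)) (+-comm q p) ⟩
    p + q ∎
    where
    open ≡-Reasoning
    X? = cross? (a ≟_) (b ≟_)

  ∑²-𝟙-cross-pair : {r₁ r₂ : Fin p} {c₁ c₂ : Fin q} → r₁ ≢ r₂ → c₁ ≢ c₂ →
                    ∑² (𝟙 ∘ cross? (pair? r₁ r₂) (pair? c₁ c₂)) + 4 ≡ 2 * (p + q)
  ∑²-𝟙-cross-pair {r₁} {r₂} {c₁} {c₂} r₁≢r₂ c₁≢c₂ = begin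
    ∑² (𝟙 ∘ X?) + 2 * 2
      ≡⟨ cong₂ (λ s t → ∑² (𝟙 ∘ X?) + s * t) (∑-𝟙-pair? r₁≢r₂) (∑-𝟙-pair? c₁≢c₂) ⟨
    ∑² (𝟙 ∘ X?) + sum (𝟙 ∘ rows?) * sum (𝟙 ∘ cols?)
      ≡⟨ ∑²-𝟙-cross rows? cols? ⟩
    q * sum (𝟙 ∘ rows?) + p * sum (𝟙 ∘ cols?)
      ≡⟨ cong₂ (λ s t → q * s + p * t) (∑-𝟙-pair? r₁≢r₂) (∑-𝟙-pair? c₁≢c₂) ⟩
    q * 2 + p * 2
      ≡⟨ trans (+-comm (q * 2) (p * 2)) (sym (*-distribʳ-+ 2 p q)) ⟩
    (p + q) * 2
      ≡⟨ *-comm (p + q) 2 ⟩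
    2 * (p + q) ∎
    where
    open ≡-Reasoning
    rows? = pair? r₁ r₂
    cols? = pair? c₁ c₂
    X? = cross? rows? cols?

distinctPairs : ℕ → ℕ
distinctPairs p = ∑² {p} {p} (λ (r₁ , r₂) → 𝟙 (¬? (r₁ ≟ r₂)))

module ColourClasses {p q k : ℕ} (col : Fin p × Fin q → Fin k) where

  classWeight : (Fin p × Fin q → ℕ) → Fin k → ℕ
  classWeight w j = ∑² (λ v → w v * 𝟙 (col v ≟ j))

  ∑-classWeight : (w : Fin p × Fin q → ℕ) → ∑[ j < k ] classWeight w j ≡ ∑² w
  ∑-classWeight w = trans (∑-∑²-comm {p} {q} (λ v j → w v * 𝟙 (col v ≟ j)))
    (sum-cong-≗ λ r → sum-cong-≗ λ c → begin
      ∑[ j < k ] (w (r , c) * 𝟙 (col (r , c) ≟ j))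
        ≡⟨ *-distribˡ-sum (w (r , c)) (λ j → 𝟙 (col (r , c) ≟ j)) ⟨
      w (r , c) * ∑[ j < k ] 𝟙 (col (r , c) ≟ j)
        ≡⟨ cong (w (r , c) *_) (∑-𝟙-≟ (col (r , c))) ⟩
      w (r , c) * 1
        ≡⟨ *-identityʳ (w (r , c)) ⟩
      w (r , c) ∎)
    where open ≡-Reasoning

  colours≤∑² : {w : Fin p × Fin q → ℕ} → (∀ j → 1 ≤ classWeight w j) → k ≤ ∑² w
  colours≤∑² {w} w≥1 = subst (k ≤_) (∑-classWeight w) (n≤∑ w≥1)

  colours+2≤∑² : {w : Fin p × Fin q → ℕ} {i i′ : Fin k} → (∀ j → 1 ≤ classWeight w j) → i ≢ i′ →
                 2 ≤ classWeight w i → 2 ≤ classWeight w i′ → k + 2 ≤ ∑² w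
  colours+2≤∑² {w} w≥1 i≢i′ wi≥2 wi′≥2 =
    subst (k + 2 ≤_) (∑-classWeight w) (n+2≤∑ w≥1 i≢i′ wi≥2 wi′≥2)

  weight-at : (w : Fin p × Fin q → ℕ) {v : Fin p × Fin q} {j : Fin k} → col v ≡ j →
              w v * 𝟙 (col v ≟ j) ≡ w v
  weight-at w {v} {j} colv≡j = trans (cong (w v *_) (𝟙-yes (col v ≟ j) colv≡j)) (*-identityʳ (w v))

  module _ {X : Pred (Fin p × Fin q) ℓ} (X? : Decidable X) where

    1≤classWeight-𝟙 : {v : Fin p × Fin q} {j : Fin k} → X v → col v ≡ j → 1 ≤ classWeight (𝟙 ∘ X?) j
    1≤classWeight-𝟙 {v} {j} Xv colv≡j =
      subst (_≤ classWeight (𝟙 ∘ X?) j) (trans (weight-at (𝟙 ∘ X?) colv≡j) (𝟙-yes (X? v) Xv))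
        (≤-∑² (λ v → 𝟙 (X? v) * 𝟙 (col v ≟ j)) v)

    2≤classWeight-𝟙 : {r r′ : Fin p} {c c′ : Fin q} {j : Fin k} → r ≢ r′ → X (r , c) → X (r′ , c′) →
                      col (r , c) ≡ j → col (r′ , c′) ≡ j → 2 ≤ classWeight (𝟙 ∘ X?) j
    2≤classWeight-𝟙 {r} {r′} {c} {c′} {j} r≢r′ X₁ X₂ col≡j col′≡j =
      subst (_≤ classWeight (𝟙 ∘ X?) j)
        (cong₂ _+_ (trans (weight-at (𝟙 ∘ X?) col≡j) (𝟙-yes (X? (r , c)) X₁))
                   (trans (weight-at (𝟙 ∘ X?) col′≡j) (𝟙-yes (X? (r′ , c′)) X₂)))
        (two-rows-≤-∑² (λ v → 𝟙 (X? v) * 𝟙 (col v ≟ j)) c c′ r≢r′)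

  rowCount : Fin k → Fin p → ℕ
  rowCount j r = ∑[ c < q ] 𝟙 (col (r , c) ≟ j)

  classSize : Fin k → ℕ
  classSize j = ∑[ r < p ] rowCount j r

  rowCount>0 : {r : Fin p} {c : Fin q} {j : Fin k} → col (r , c) ≡ j → 0 < rowCount j r
  rowCount>0 {r} {c} {j} col≡j =
    subst (_≤ rowCount j r) (𝟙-yes (col (r , c) ≟ j) col≡j) (≤-∑ (λ c → 𝟙 (col (r , c) ≟ j)) c)

  rowCount>0⇒ : {j : Fin k} {r : Fin p} → 0 < rowCount j r → ∃[ c ] col (r , c) ≡ j
  rowCount>0⇒ {j} {r} pos = let c , pos′ = ∑>0⇒∃ (λ c → 𝟙 (col (r , c) ≟ j)) pos
                            in c , 𝟙>0⇒ (col (r , c) ≟ j) pos′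

  ∑-classSize : ∑[ j < k ] classSize j ≡ p * q
  ∑-classSize = begin
    ∑[ j < k ] classSize j
      ≡⟨ sum-cong-≗ (λ j → sum-cong-≗ λ r → sum-cong-≗ λ c → *-identityˡ (𝟙 (col (r , c) ≟ j))) ⟨
    ∑[ j < k ] classWeight (λ _ → 1) j
      ≡⟨ ∑-classWeight (λ _ → 1) ⟩
    ∑² {p} {q} (λ _ → 1)
      ≡⟨ ∑²-column {p} {q} (λ _ → 1) ⟩
    p * ∑[ c < q ] 1
      ≡⟨ cong (p *_) (trans (∑-const q 1) (*-identityʳ q)) ⟩
    p * q ∎
    where open ≡-Reasoning

module ProperColouring {p q k : ℕ} {col : Fin p × Fin q → Fin k} (proper : IsProper {p} {q} col) where
  open ColourClasses col

  colour-injective-on-row : {r : Fin p} {c c′ : Fin q} → col (r , c) ≡ col (r , c′) → c ≡ c′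
  colour-injective-on-row {r} {c} {c′} col≡col′ with c ≟ c′
  ... | yes c≡c′ = c≡c′
  ... | no c≢c′  = contradiction col≡col′ (proper (r , c) (r , c′) (inj₁ (refl , c≢c′)))

  colour-injective-on-column : {r r′ : Fin p} {c : Fin q} → col (r , c) ≡ col (r′ , c) → r ≡ r′
  colour-injective-on-column {r} {r′} {c} col≡col′ with r ≟ r′
  ... | yes r≡r′ = r≡r′
  ... | no r≢r′  = contradiction col≡col′ (proper (r , c) (r′ , c) (inj₂ (r≢r′ , refl)))

  rowCount≤1 : (j : Fin k) (r : Fin p) → rowCount j r ≤ 1
  rowCount≤1 j r = ∑-𝟙-≤1 (λ c → col (r , c) ≟ j)
    (λ c c′ col≡j col′≡j → colour-injective-on-row (trans col≡j (sym col′≡j)))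

  2≤classSize : {v w : Fin p × Fin q} {j : Fin k} → v ≢ w → col v ≡ j → col w ≡ j → 2 ≤ classSize j
  2≤classSize {r , c} {r′ , c′} {j} v≢w colv≡j colw≡j =
    ≤-trans (+-mono-≤ (rowCount>0 colv≡j) (rowCount>0 colw≡j)) (two-≤-∑ (rowCount j) r≢r′)
    where
    r≢r′ : r ≢ r′
    r≢r′ refl = v≢w (cong (r ,_) (colour-injective-on-row (trans colv≡j (sym colw≡j))))

  pair-class-vertices : {j : Fin k} {r₁ r₂ : Fin p} {c₁ c₂ : Fin q} → classSize j ≡ 2 → r₁ ≢ r₂ →
                        col (r₁ , c₁) ≡ j → col (r₂ , c₂) ≡ j →
                        ∀ {v} → col v ≡ j → v ≡ (r₁ , c₁) ⊎ v ≡ (r₂ , c₂)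
  pair-class-vertices {j} {r₁} {r₂} size≡2 r₁≢r₂ col₁≡j col₂≡j {r , c} col≡j with r₁ ≟ r | r₂ ≟ r
  ... | yes refl | _        = inj₁ (cong (r ,_) (colour-injective-on-row (trans col≡j (sym col₁≡j))))
  ... | no _     | yes refl = inj₂ (cong (r ,_) (colour-injective-on-row (trans col≡j (sym col₂≡j))))
  ... | no r₁≢r  | no r₂≢r  = contradiction (subst (3 ≤_) size≡2 three-rows) λ { (s≤s (s≤s ())) }
    where
    three-rows : 3 ≤ classSize j
    three-rows = ≤-trans (+-mono-≤ (+-mono-≤ (rowCount>0 col₁≡j) (rowCount>0 col₂≡j)) (rowCount>0 col≡j))
                         (three-≤-∑ (rowCount j) r₁≢r₂ r₁≢r r₂≢r)

module CompleteColouring {p q k : ℕ} {col : Fin p × Fin q → Fin k}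
                         (colouring : IsCompleteColouring p q k col) where
  open ColourClasses col

  proper : IsProper {p} {q} col
  proper = proj₁ colouring

  complete : IsComplete {p} {q} col
  complete = proj₁ (proj₂ colouring)

  used : ∀ j → ∃[ v ] col v ≡ j
  used = proj₂ (proj₂ colouring)

  open ProperColouring proper

  classSize≤1⇒k<p+q : {i : Fin k} → classSize i ≤ 1 → k < p + q
  classSize≤1⇒k<p+q {i} size≤1 = begin-strict
    k                ≤⟨ colours≤∑² meets ⟩
    ∑² (𝟙 ∘ X?)      <⟨ m<m+n _ z<s ⟩
    ∑² (𝟙 ∘ X?) + 1  ≡⟨ ∑²-𝟙-cross-point a b ⟩
    p + q            ∎
    where
    open ≤-Reasoning
    u = proj₁ (used i)
    a = proj₁ u
    b = proj₂ u
    X? = cross? (a ≟_) (b ≟_)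
    only-u : ∀ {v} → col v ≡ i → v ≡ u
    only-u {v} colv≡i with ≡-dec _≟_ _≟_ v u
    ... | yes v≡u = v≡u
    ... | no v≢u  = contradiction (≤-trans (2≤classSize v≢u colv≡i (proj₂ (used i))) size≤1) λ { (s≤s ()) }
    meets : ∀ j → 1 ≤ classWeight (𝟙 ∘ X?) j
    meets j with i ≟ j
    ... | yes refl = 1≤classWeight-𝟙 X? (inj₁ refl) (proj₂ (used i))
    ... | no i≢j with x , y , x~y , colx≡i , coly≡j ← complete i j i≢j
                 with refl ← only-u colx≡i
                 = 1≤classWeight-𝟙 X? (CartAdj⇒Cross x~y) coly≡j

  p+q≤k⇒2≤classSize : p + q ≤ k → ∀ j → 2 ≤ classSize j
  p+q≤k⇒2≤classSize p+q≤k j with 2 ≤? classSize j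
  ... | yes 2≤size = 2≤size
  ... | no 2≰size  = contradiction p+q≤k (<⇒≱ (classSize≤1⇒k<p+q (≤-pred (≰⇒> 2≰size))))

  pair-class-rows-unshared : {i i′ : Fin k} {r₁ r₂ : Fin p} → classSize i ≡ 2 → i ≢ i′ → r₁ ≢ r₂ →
                             0 < rowCount i r₁ → 0 < rowCount i r₂ →
                             0 < rowCount i′ r₁ → 0 < rowCount i′ r₂ →
                             k + 6 ≤ 2 * (p + q)
  pair-class-rows-unshared {i} {i′} {r₁} {r₂} size≡2 i≢i′ r₁≢r₂ i∈r₁ i∈r₂ i′∈r₁ i′∈r₂
    with c₁ , col₁≡i  ← rowCount>0⇒ i∈r₁
       | c₂ , col₂≡i  ← rowCount>0⇒ i∈r₂
       | d₁ , col₁≡i′ ← rowCount>0⇒ i′∈r₁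
       | d₂ , col₂≡i′ ← rowCount>0⇒ i′∈r₂
    = begin
      k + 6            ≡⟨ +-assoc k 2 4 ⟨
      k + 2 + 4        ≤⟨ +-monoˡ-≤ 4 (colours+2≤∑² meets i≢i′ i-twice i′-twice) ⟩
      ∑² (𝟙 ∘ X?) + 4  ≡⟨ ∑²-𝟙-cross-pair r₁≢r₂ c₁≢c₂ ⟩
      2 * (p + q)      ∎
    where
    open ≤-Reasoning
    c₁≢c₂ : c₁ ≢ c₂
    c₁≢c₂ refl = r₁≢r₂ (colour-injective-on-column (trans col₁≡i (sym col₂≡i)))
    X? = cross? (pair? r₁ r₂) (pair? c₁ c₂)
    i-twice : 2 ≤ classWeight (𝟙 ∘ X?) i
    i-twice = 2≤classWeight-𝟙 X? r₁≢r₂ (inj₁ (inj₁ refl)) (inj₁ (inj₂ refl)) col₁≡i col₂≡i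
    i′-twice : 2 ≤ classWeight (𝟙 ∘ X?) i′
    i′-twice = 2≤classWeight-𝟙 X? r₁≢r₂ (inj₁ (inj₁ refl)) (inj₁ (inj₂ refl)) col₁≡i′ col₂≡i′
    meets : ∀ j → 1 ≤ classWeight (𝟙 ∘ X?) j
    meets j with i ≟ j
    ... | yes refl = 1≤classWeight-𝟙 X? (inj₁ (inj₁ refl)) col₁≡i
    ... | no i≢j with x , y , x~y , colx≡i , coly≡j ← complete i j i≢j
                 with pair-class-vertices size≡2 r₁≢r₂ col₁≡i col₂≡i colx≡i
    ...   | inj₁ refl = 1≤classWeight-𝟙 X? (Sum.map inj₁ inj₁ (CartAdj⇒Cross x~y)) coly≡j
    ...   | inj₂ refl = 1≤classWeight-𝟙 X? (Sum.map inj₂ inj₂ (CartAdj⇒Cross x~y)) coly≡j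

  pairClassCount : ℕ
  pairClassCount = ∑[ j < k ] 𝟙 (classSize j ≟ℕ 2)

  3k≤pq+pairClassCount : p + q ≤ k → 3 * k ≤ p * q + pairClassCount
  3k≤pq+pairClassCount p+q≤k = begin
    3 * k
      ≡⟨ trans (∑-const k 3) (*-comm k 3) ⟨
    ∑[ j < k ] 3
      ≤⟨ ∑-mono-≤ 3≤size+𝟙 ⟩
    ∑[ j < k ] (classSize j + 𝟙 (classSize j ≟ℕ 2))
      ≡⟨ ∑-distrib-+ classSize (λ j → 𝟙 (classSize j ≟ℕ 2)) ⟩
    ∑[ j < k ] classSize j + pairClassCount
      ≡⟨ cong (_+ pairClassCount) ∑-classSize ⟩
    p * q + pairClassCount ∎
    where
    open ≤-Reasoning
    3≤size+𝟙 : ∀ j → 3 ≤ classSize j + 𝟙 (classSize j ≟ℕ 2)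
    3≤size+𝟙 j with classSize j ≟ℕ 2
    ... | yes size≡2 = ≤-reflexive (cong (_+ 1) (sym size≡2))
    ... | no size≢2  =
      ≤-trans (≤∧≢⇒< (p+q≤k⇒2≤classSize p+q≤k j) (size≢2 ∘ sym)) (m≤m+n (classSize j) 0)

  PairClassAt : Fin p × Fin p → Fin k → Set
  PairClassAt (r₁ , r₂) j = r₁ ≢ r₂ × classSize j ≡ 2 × 0 < rowCount j r₁ × 0 < rowCount j r₂

  pairClassAt? : ∀ rr j → Dec (PairClassAt rr j)
  pairClassAt? (r₁ , r₂) j =
    ¬? (r₁ ≟ r₂) ×-dec classSize j ≟ℕ 2 ×-dec 0 <? rowCount j r₁ ×-dec 0 <? rowCount j r₂

  pair-class-meets-two-rows : ∀ {j} → classSize j ≡ 2 → 2 ≤ ∑² {p} {p} (λ rr → 𝟙 (pairClassAt? rr j))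
  pair-class-meets-two-rows {j} size≡2 =
    let r₁ , j∈r₁         = ∑>0⇒∃ (rowCount j) (subst (0 <_) (sym size≡2) z<s)
        r₂ , r₂≢r₁ , j∈r₂ = f<∑⇒∃-other (rowCount j) r₁
                              (subst (rowCount j r₁ <_) (sym size≡2) (s≤s (rowCount≤1 j r₁)))
    in subst (_≤ ∑² {p} {p} (λ rr → 𝟙 (pairClassAt? rr j)))
         (cong₂ _+_ (𝟙-yes (pairClassAt? (r₁ , r₂) j) (r₂≢r₁ ∘ sym , size≡2 , j∈r₁ , j∈r₂))
                    (𝟙-yes (pairClassAt? (r₂ , r₁) j) (r₂≢r₁ , size≡2 , j∈r₂ , j∈r₁)))
         (two-rows-≤-∑² (λ rr → 𝟙 (pairClassAt? rr j)) r₂ r₁ (r₂≢r₁ ∘ sym))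

  at-most-one-pair-class-at : 2 * (p + q) < k + 6 → ∀ rr →
                              ∑[ j < k ] 𝟙 (pairClassAt? rr j) ≤ 𝟙 (¬? (proj₁ rr ≟ proj₂ rr))
  at-most-one-pair-class-at 2[p+q]<k+6 (r₁ , r₂) =
    ∑-𝟙-≤-𝟙 (pairClassAt? (r₁ , r₂)) (¬? (r₁ ≟ r₂)) (λ _ → proj₁) unique
    where
    unique : ∀ j j′ → PairClassAt (r₁ , r₂) j → PairClassAt (r₁ , r₂) j′ → j ≡ j′
    unique j j′ (r₁≢r₂ , size≡2 , j∈r₁ , j∈r₂) (_ , _ , j′∈r₁ , j′∈r₂) with j ≟ j′
    ... | yes j≡j′ = j≡j′
    ... | no j≢j′  = contradiction
                       (pair-class-rows-unshared size≡2 j≢j′ r₁≢r₂ j∈r₁ j∈r₂ j′∈r₁ j′∈r₂)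
                       (<⇒≱ 2[p+q]<k+6)

  2*pairClassCount≤distinctPairs : 2 * (p + q) < k + 6 → 2 * pairClassCount ≤ distinctPairs p
  2*pairClassCount≤distinctPairs 2[p+q]<k+6 = begin
    2 * pairClassCount
      ≡⟨ *-distribˡ-sum 2 (λ j → 𝟙 (classSize j ≟ℕ 2)) ⟩
    ∑[ j < k ] (2 * 𝟙 (classSize j ≟ℕ 2))
      ≤⟨ ∑-mono-≤ (λ j → *-𝟙-≤ 2 (classSize j ≟ℕ 2) pair-class-meets-two-rows) ⟩
    ∑[ j < k ] ∑² {p} {p} (λ rr → 𝟙 (pairClassAt? rr j))
      ≡⟨ ∑-∑²-comm {p} {p} (λ rr j → 𝟙 (pairClassAt? rr j)) ⟩
    ∑² {p} {p} (λ rr → ∑[ j < k ] 𝟙 (pairClassAt? rr j))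
      ≤⟨ ∑²-mono-≤ {p} {p} (at-most-one-pair-class-at 2[p+q]<k+6) ⟩
    distinctPairs p ∎
    where open ≤-Reasoning

  6k≤2pq+distinctPairs : p + q ≤ k → 2 * (p + q) < k + 6 → 6 * k ≤ 2 * (p * q) + distinctPairs p
  6k≤2pq+distinctPairs p+q≤k 2[p+q]<k+6 = begin
    6 * k
      ≡⟨ *-assoc 2 3 k ⟩
    2 * (3 * k)
      ≤⟨ *-monoʳ-≤ 2 (3k≤pq+pairClassCount p+q≤k) ⟩
    2 * (p * q + pairClassCount)
      ≡⟨ *-distribˡ-+ 2 (p * q) pairClassCount ⟩
    2 * (p * q) + 2 * pairClassCount
      ≤⟨ +-monoʳ-≤ (2 * (p * q)) (2*pairClassCount≤distinctPairs 2[p+q]<k+6) ⟩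
    2 * (p * q) + distinctPairs p ∎
    where open ≤-Reasoning

lemma12 : (q : ℕ) → 7 ≤ q → (k : ℕ) → (col : Fin 6 × Fin q → Fin k) →
    IsCompleteColouring 6 q k col → k ≤ 2 * q + 6
-- The argument does not need q ≥ 7.
lemma12 q _ k col colouring with k ≤? 2 * q + 6
... | yes k≤2q+6 = k≤2q+6
... | no k≰2q+6  = contradiction (+-cancelˡ-≤ (12 * q) 42 30 12q+42≤12q+30) (from-no (42 ≤? 30))
  where
  open CompleteColouring colouring
  open ≤-Reasoning
  6+q+[q+1] : ∀ q → 6 + q + (q + 1) ≡ 2 * q + 7
  6+q+[q+1] = solve-∀
  2q+7+6 : ∀ q → 2 * q + 7 + 6 ≡ suc (2 * (6 + q))
  2q+7+6 = solve-∀
  12q+42 : ∀ q → 12 * q + 42 ≡ 6 * (2 * q + 7)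
  12q+42 = solve-∀
  distinctPairs-6 : distinctPairs 6 ≡ 30
  distinctPairs-6 = refl
  2q+7≤k : 2 * q + 7 ≤ k
  2q+7≤k = subst (_≤ k) (sym (+-suc (2 * q) 6)) (≰⇒> k≰2q+6)
  6+q≤k : 6 + q ≤ k
  6+q≤k = ≤-trans (subst (6 + q ≤_) (6+q+[q+1] q) (m≤m+n (6 + q) (q + 1))) 2q+7≤k
  2[6+q]<k+6 : 2 * (6 + q) < k + 6
  2[6+q]<k+6 = subst (_≤ k + 6) (2q+7+6 q) (+-monoˡ-≤ 6 2q+7≤k)
  12q+42≤12q+30 : 12 * q + 42 ≤ 12 * q + 30
  12q+42≤12q+30 = begin
    12 * q + 42                    ≡⟨ 12q+42 q ⟩
    6 * (2 * q + 7)                ≤⟨ *-monoʳ-≤ 6 2q+7≤k ⟩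
    6 * k                          ≤⟨ 6k≤2pq+distinctPairs 6+q≤k 2[6+q]<k+6 ⟩
    2 * (6 * q) + distinctPairs 6  ≡⟨ cong₂ _+_ (*-assoc 2 6 q) distinctPairs-6 ⟨
    12 * q + 30                    ∎
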